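{- There exists a test.
   Context: Let $\varphi:\omega\to\omega^2$ be the bijection with inverse $\langle n,p\rangle:=\varphi^{ -1}(n,p)=\left(\sum_{k\le n+p}k\right)+p$, and write $\varphi(q)=((q)_0,(q)_1)$. A set $E\subseteq\bigcup_{q\in\omega}2^q\times 2^q$ is a test if: (a) for every $q\in\omega$ there is a unique $(s_q,t_q)\in E\cap(2^q\times 2^q)$; (b) for all $m,p\in\omega$ and $u\in 2^{<\omega}$ there is $v\in 2^{<\omega}$ with $(s_p0uv,t_p1uv)\in E$ and $(|t_p1uv|-1)_0=m$; (c) for every $n>0$ there are $q<n$ and $w\in 2^{<\omega}$ with $s_n=s_q0w$ and $t_n=t_q1w$ (juxtaposition denotes concatenation). -}

module Defs where

open import Data.Nat using (ℕ; zero; suc; _+_; _∸_; _<_)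
open import Data.Bool using (Bool; true; false)
open import Data.List using (List; []; _∷_; _++_; length)
open import Data.Product using (Σ; _×_; ∃; ∃-syntax)
open import Relation.Binary.PropositionalEquality using (_≡_)

-- binary strings 2^{<ω}; 0 = false, 1 = true
Str : Set
Str = List Bool

tri : ℕ → ℕ
tri zero    = zero
tri (suc n) = suc n + tri n

-- ⟨n,p⟩ = (Σ_{k ≤ n+p} k) + p  (= φ⁻¹(n,p))
pair : ℕ → ℕ → ℕ
pair n p = tri (n + p) + p

-- (q)₀ ≡ m  : the first coordinate of φ(q) is m, i.e. q = ⟨m,p⟩ for some p
Fst≡ : ℕ → ℕ → Set
Fst≡ q m = Σ ℕ λ p → pair m p ≡ q

-- subsets E ⊆ ⋃_q 2^q × 2^q, as predicates on pairs of strings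
Rel : Set₁
Rel = Str → Str → Set

-- Condition (a), with s,t the chosen witnesses (s q, t q) = (s_q, t_q)
CondA : Rel → (ℕ → Str) → (ℕ → Str) → Set
CondA E s t =
  (∀ q → length (s q) ≡ q × length (t q) ≡ q × E (s q) (t q))
  × (∀ q (s' t' : Str) → length s' ≡ q → length t' ≡ q → E s' t'
       → s' ≡ s q × t' ≡ t q)

InUnion : Rel → Set
InUnion E = ∀ (x y : Str) → E x y → length x ≡ length y

CondB : Rel → (ℕ → Str) → (ℕ → Str) → Set
CondB E s t = ∀ (m p : ℕ) (u : Str) → ∃[ v ]
  (E (s p ++ (false ∷ u ++ v)) (t p ++ (true ∷ u ++ v))
   × Fst≡ (length (t p ++ (true ∷ u ++ v)) ∸ 1) m)

CondC : (ℕ → Str) → (ℕ → Str) → Set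
CondC s t = ∀ n → 0 < n → ∃[ q ] (q < n × ∃[ w ]
  (s n ≡ s q ++ (false ∷ w) × t n ≡ t q ++ (true ∷ w)))

IsTest : Rel → Set
IsTest E = InUnion E × Σ (ℕ → Str) λ s → Σ (ℕ → Str) λ t →
  CondA E s t × CondB E s t × CondC s t

module Submission where

-- A test is built as a binary tree of pairs of strings grown one node at a time.
-- Node 0 is the pair of empty strings; node y+1 is attached below an earlier
-- node q y by an edge labelled w y, i.e.
--     s_{y+1} = s_{q y} 0 w_y ,   t_{y+1} = t_{q y} 1 w_y ,
-- where q y + |w y| = y so that node y+1 has length y+1.  For ANY such growth
-- rule the set E = {(s_q, t_q)} satisfies (a), (c) and lies in ⋃ 2^q × 2^q;
-- condition (b) holds as soon as the rule is "rich": every request (m, p, u)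
-- is served at some step y with (y)₀ = m, q y = p and w y extending u.

open import Defs
open import Data.Product using (Σ; _×_; _,_; proj₁; proj₂; ∃-syntax)
open import Data.Nat using (ℕ; zero; suc; _+_; _∸_; _<_; _≤_; _≤?_; z≤n; s≤s)
open import Data.Nat.Properties
open import Data.Bool using (Bool; true; false)
open import Data.List using ([]; _∷_; _++_; length; replicate)
open import Data.List.Properties using (length-++; length-replicate)
open import Relation.Nullary using (yes; no)
open import Relation.Nullary.Negation using (contradiction)
open import Relation.Binary.PropositionalEquality
open ≡-Reasoning

next : ℕ × ℕ → ℕ × ℕ
next (zero  , k) = (suc k , 0)
next (suc m , k) = (m , suc k)

-- φ, enumerating ω² diagonal by diagonal
unpair : ℕ → ℕ × ℕ
unpair zero    = (0 , 0)
unpair (suc x) = next (unpair x)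

pair-along-diagonal : ∀ m k → pair m (suc k) ≡ suc (pair (suc m) k)
pair-along-diagonal m k rewrite +-suc m k | +-suc (tri (suc (m + k))) k = refl

pair-next-diagonal : ∀ k → pair (suc k) 0 ≡ suc (pair 0 k)
pair-next-diagonal k rewrite +-identityʳ k | +-identityʳ (k + tri k) =
  cong suc (+-comm k (tri k))

unpair-pair : ∀ m k → unpair (pair m k) ≡ (m , k)
unpair-pair m k = on-diagonal (m + k) m k refl
  where
  on-diagonal : ∀ d m k → m + k ≡ d → unpair (pair m k) ≡ (m , k)
  on-diagonal zero    zero    zero    _ = refl
  on-diagonal (suc d) zero    zero    ()
  on-diagonal zero    (suc m) zero    ()
  on-diagonal (suc d) (suc m) zero    e = trans (cong unpair (pair-next-diagonal m))
    (cong next (on-diagonal d zero m (trans (sym (+-identityʳ m)) (suc-injective e))))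
  on-diagonal d       m       (suc k) e = trans (cong unpair (pair-along-diagonal m k))
    (cong next (on-diagonal d (suc m) k (trans (sym (+-suc m k)) e)))

tri-≥ : ∀ n → n ≤ tri n
tri-≥ zero    = z≤n
tri-≥ (suc n) = m≤m+n (suc n) (tri n)

sum≤pair : ∀ m k → m + k ≤ pair m k
sum≤pair m k = ≤-trans (tri-≥ (m + k)) (m≤m+n (tri (m + k)) k)

code : Str → ℕ
code []          = 0
code (false ∷ u) = suc (code u + code u)
code (true  ∷ u) = suc (suc (code u + code u))

-- binary increment on strings read least significant bit first
increment : Str → Str
increment []          = false ∷ []
increment (false ∷ u) = true ∷ u
increment (true  ∷ u) = false ∷ increment u

decode : ℕ → Str
decode zero    = []
decode (suc n) = increment (decode n)

decode-odd  : ∀ n → decode (suc (n + n)) ≡ false ∷ decode n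
decode-even : ∀ n → decode (suc (suc (n + n))) ≡ true ∷ decode n
decode-odd zero    = refl
decode-odd (suc n) rewrite +-suc n n | decode-even n = refl
decode-even n rewrite decode-odd n = refl

decode-code : ∀ u → decode (code u) ≡ u
decode-code []          = refl
decode-code (false ∷ u) = trans (decode-odd (code u)) (cong (false ∷_) (decode-code u))
decode-code (true ∷ u)  = trans (decode-even (code u)) (cong (true ∷_) (decode-code u))

length≤code : ∀ u → length u ≤ code u
length≤code []          = z≤n
length≤code (false ∷ u) = s≤s (≤-trans (length≤code u) (m≤m+n (code u) (code u)))
length≤code (true ∷ u)  =
  s≤s (≤-trans (length≤code u) (≤-trans (m≤m+n (code u) (code u)) (n≤1+n _)))

-- The tree determined by a growth rule; node c n is s_n for c = false and t_n
-- for c = true (c being the bit that opens each new edge).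
module Tree (q : ℕ → ℕ) (w : ℕ → Str) (fits : ∀ y → q y + length (w y) ≡ y) where

  q≤ : ∀ y → q y ≤ y
  q≤ y = subst (q y ≤_) (fits y) (m≤m+n (q y) (length (w y)))

  -- node n of the branch-c tree, computed with enough fuel (> n)
  grow : Bool → ℕ → ℕ → Str
  grow c zero    _       = []
  grow c (suc f) zero    = []
  grow c (suc f) (suc y) = grow c f (q y) ++ c ∷ w y

  grow-stable : ∀ c a b n → n < a → n < b → grow c a n ≡ grow c b n
  grow-stable c (suc a) (suc b) zero    _       _       = refl
  grow-stable c (suc a) (suc b) (suc y) (s≤s ha) (s≤s hb) =
    cong (_++ c ∷ w y)
         (grow-stable c a b (q y) (≤-<-trans (q≤ y) ha) (≤-<-trans (q≤ y) hb))

  grow-length : ∀ c f n → n < f → length (grow c f n) ≡ n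
  grow-length c (suc f) zero    _       = refl
  grow-length c (suc f) (suc y) (s≤s h) = begin
    length (grow c f (q y) ++ c ∷ w y)       ≡⟨ length-++ (grow c f (q y)) ⟩
    length (grow c f (q y)) + suc (length (w y))
      ≡⟨ cong (_+ suc (length (w y))) (grow-length c f (q y) (≤-<-trans (q≤ y) h)) ⟩
    q y + suc (length (w y))                 ≡⟨ +-suc (q y) (length (w y)) ⟩
    suc (q y + length (w y))                 ≡⟨ cong suc (fits y) ⟩
    suc y                                    ∎

  node : Bool → ℕ → Str
  node c n = grow c (suc n) n

  node-length : ∀ c n → length (node c n) ≡ n
  node-length c n = grow-length c (suc n) n ≤-refl

  node-suc : ∀ c y → node c (suc y) ≡ node c (q y) ++ c ∷ w y
  node-suc c y =
    cong (_++ c ∷ w y) (grow-stable c (suc y) (suc (q y)) (q y) (s≤s (q≤ y)) ≤-refl)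

  s t : ℕ → Str
  s = node false
  t = node true

  E : Rel
  E x y = Σ ℕ λ n → x ≡ s n × y ≡ t n

  inUnion : InUnion E
  inUnion _ _ (n , refl , refl) = trans (node-length false n) (sym (node-length true n))

  condA : CondA E s t
  condA = (λ n → node-length false n , node-length true n , (n , refl , refl)) , unique
    where
    unique : ∀ n (s' t' : Str) → length s' ≡ n → length t' ≡ n → E s' t'
           → s' ≡ s n × t' ≡ t n
    unique n _ _ ls _ (n' , refl , refl) with trans (sym (node-length false n')) ls
    ... | refl = refl , refl

  condC : CondC s t
  condC zero    ()
  condC (suc y) _ = q y , s≤s (q≤ y) , w y , node-suc false y , node-suc true y

  Rich : Set
  Rich = ∀ (m p : ℕ) (u : Str) →
    ∃[ y ] (Fst≡ y m × q y ≡ p × ∃[ v ] (w y ≡ u ++ v))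

  condB : Rich → CondB E s t
  condB rich m p u with rich m p u
  ... | y , (k , mk≡y) , refl , v , wy≡uv = v , (suc y , sy , ty) , (k , first)
    where
    sy : s (q y) ++ false ∷ u ++ v ≡ s (suc y)
    sy = sym (trans (node-suc false y) (cong (λ l → s (q y) ++ false ∷ l) wy≡uv))
    ty : t (q y) ++ true ∷ u ++ v ≡ t (suc y)
    ty = sym (trans (node-suc true y) (cong (λ l → t (q y) ++ true ∷ l) wy≡uv))
    first : pair m k ≡ length (t (q y) ++ true ∷ u ++ v) ∸ 1
    first = trans mk≡y (cong (_∸ 1) (sym (trans (cong length ty) (node-length true (suc y)))))

  isTest : Rich → IsTest E
  isTest rich = inUnion , s , t , condA , condB rich , condC

serve : ℕ → ℕ × Str → ℕ × Str
serve y (p , u) with p + length u ≤? y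
... | yes _ = p , u ++ replicate (y ∸ (p + length u)) false
... | no _  = y , []

serve-fits : ∀ y r → proj₁ (serve y r) + length (proj₂ (serve y r)) ≡ y
serve-fits y (p , u) with p + length u ≤? y
... | no _     = +-identityʳ y
... | yes fit = begin
  p + length (u ++ replicate (y ∸ (p + length u)) false)
    ≡⟨ cong (p +_) (length-++ u) ⟩
  p + (length u + length (replicate (y ∸ (p + length u)) false))
    ≡⟨ cong (λ z → p + (length u + z)) (length-replicate (y ∸ (p + length u))) ⟩
  p + (length u + (y ∸ (p + length u)))
    ≡⟨ sym (+-assoc p (length u) _) ⟩
  p + length u + (y ∸ (p + length u))
    ≡⟨ m+[n∸m]≡n fit ⟩
  y ∎

serve-accepts : ∀ y p u → p + length u ≤ y →
  serve y (p , u) ≡ (p , u ++ replicate (y ∸ (p + length u)) false)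
serve-accepts y p u fit with p + length u ≤? y
... | yes _   = refl
... | no ¬fit = contradiction fit ¬fit

-- step y = ⟨m,⟨p,code u⟩⟩ carries the request (p, u)
request : ℕ → ℕ × Str
request y = proj₁ (unpair k) , decode (proj₂ (unpair k))
  where k = proj₂ (unpair y)

request-pair : ∀ m p u → request (pair m (pair p (code u))) ≡ (p , u)
request-pair m p u
  rewrite unpair-pair m (pair p (code u)) | unpair-pair p (code u) | decode-code u = refl

request-fits : ∀ m p u → p + length u ≤ pair m (pair p (code u))
request-fits m p u = ≤-trans (+-monoʳ-≤ p (length≤code u))
  (≤-trans (sum≤pair p (code u))
  (≤-trans (m≤n+m k m) (sum≤pair m k)))
  where k = pair p (code u)

rule : ℕ → ℕ × Str
rule y = serve y (request y)

open Tree (λ y → proj₁ (rule y)) (λ y → proj₂ (rule y)) (λ y → serve-fits y (request y))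

rule-rich : Rich
rule-rich m p u =
  y , (pair p (code u) , refl) , cong proj₁ served , _ , cong proj₂ served
  where
  y = pair m (pair p (code u))
  served : rule y ≡ (p , u ++ replicate (y ∸ (p + length u)) false)
  served = trans (cong (serve y) (request-pair m p u)) (serve-accepts y p u (request-fits m p u))

lemma3p3 : Σ Rel IsTest
lemma3p3 = E , isTest rule-rich
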